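{- Let $H = \Theta(2,4,4)$ and $G = H^2$. Then $G$ is equitably $5$-choosable.
   Context: $\Theta(l_1,\ldots,l_m)$ denotes a generalized theta graph: two vertices $u,w$ joined by $m$ internally disjoint paths of lengths $l_1,\ldots,l_m$. $H^2$ is the square of $H$ (two vertices adjacent iff at distance at most 2 in $H$). A $k$-assignment $L$ assigns to each vertex a list of exactly $k$ colors; an equitable $L$-coloring of $G$ is a proper coloring $f$ with $f(v)\in L(v)$ using each color at most $\lceil |V(G)|/k\rceil$ times; $G$ is equitably $k$-choosable if it has an equitable $L$-coloring for every $k$-assignment $L$. -}

module Defs where

open import Data.Nat using (ℕ; zero; suc; _+_; _∸_; _≤_; _≟_)
open import Data.Nat.DivMod using (_/_)
open import Data.Fin using (Fin; toℕ)
open import Data.List using (List; []; _∷_; _++_; length; filter; map; allFin)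
open import Data.Nat.ListAction using (sum)
open import Data.List.Membership.Propositional using (_∈_)
open import Data.List.Relation.Unary.Unique.Propositional using (Unique)
open import Data.Product using (Σ; ∃; _×_; _,_)
open import Data.Sum using (_⊎_)
open import Relation.Binary.PropositionalEquality using (_≡_; _≢_)

Graph : ℕ → Set₁
Graph n = Fin n → Fin n → Set

fromEdges : (n : ℕ) → List (ℕ × ℕ) → Graph n
fromEdges n E x y = ((toℕ x , toℕ y) ∈ E) ⊎ ((toℕ y , toℕ x) ∈ E)

-- Vertex 0 is u, vertex 1 is w; the internal vertices of the paths are
-- numbered consecutively from 2 on: the path of length l has l ∸ 1
-- internal vertices s, s+1, …, s+l-2, with edges u–s, s–(s+1), …, (s+l-2)–w
-- (for l = 1 it is the single edge u–w).

walk : ℕ → ℕ → ℕ → List (ℕ × ℕ)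
walk prev s zero    = (prev , 1) ∷ []
walk prev s (suc m) = (prev , s) ∷ walk s (suc s) m

pathEdges : ℕ → ℕ → List (ℕ × ℕ)
pathEdges s zero    = []
pathEdges s (suc m) = walk 0 s m

thetaEdgesFrom : List ℕ → ℕ → List (ℕ × ℕ)
thetaEdgesFrom []       s = []
thetaEdgesFrom (l ∷ ls) s = pathEdges s l ++ thetaEdgesFrom ls (s + (l ∸ 1))

thetaOrder : List ℕ → ℕ
thetaOrder ls = 2 + sum (map (λ l → l ∸ 1) ls)

Θ : (ls : List ℕ) → Graph (thetaOrder ls)
Θ ls = fromEdges (thetaOrder ls) (thetaEdgesFrom ls 2)

square : {n : ℕ} → Graph n → Graph n
square H x y = x ≢ y × (H x y ⊎ ∃ λ z → H x z × H z y)

ceilDiv : ℕ → ℕ → ℕ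
ceilDiv n zero    = 0
ceilDiv n (suc k) = (n + k) / suc k

IsAssignment : {n : ℕ} → ℕ → (Fin n → List ℕ) → Set
IsAssignment k L = ∀ v → length (L v) ≡ k × Unique (L v)

Proper : {n : ℕ} → Graph n → (Fin n → ℕ) → Set
Proper G f = ∀ x y → G x y → f x ≢ f y

colourCount : {n : ℕ} → (Fin n → ℕ) → ℕ → ℕ
colourCount {n} f c = length (filter (λ v → f v ≟ c) (allFin n))

EquitableLColouring : {n : ℕ} → Graph n → ℕ → (Fin n → List ℕ) → (Fin n → ℕ) → Set
EquitableLColouring {n} G k L f =
  Proper G f × (∀ v → f v ∈ L v) × (∀ c → colourCount f c ≤ ceilDiv n k)

EquitablyChoosable : {n : ℕ} → Graph n → ℕ → Set
EquitablyChoosable G k =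
  ∀ L → IsAssignment k L → Σ _ λ f → EquitableLColouring G k L f

-- H has 9 vertices: u = 0, w = 1, the middle vertex 2 of the path of
-- length 2, and the internal vertices 3,4,5 and 6,7,8 of the two paths of
-- length 4.  Since ⌈9/5⌉ = 2, an equitable colouring must use every colour
-- at most twice.
--
-- The proof is a greedy list colouring.  We colour the vertices in the
-- order 0,1,2,3,4,5,8,6,7, and each vertex only has to avoid the colours of
-- at most four earlier vertices (its "back-constraints"); since its list
-- has five distinct colours, a free colour always exists.  The
-- back-constraints are chosen so that
--   * every edge of G joins a vertex to one of its back-constraints, so the
--     colouring is proper, and
--   * any two distinct vertices of {1,2,3,4,5}, or of {0,6,7,8}, are joined
--     by a back-constraint, so each colour occurs at most once in each of
--     these two classes, hence at most twice in total.

module Submission where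

open import Defs
open import Data.Nat using (ℕ; _≤_; _<_; z≤n; _<?_)
open import Data.Nat.Properties using (≤-<-trans; <-irrefl; ≤-trans; ≤-reflexive)
open import Data.Fin using (Fin; toℕ; #_)
import Data.Fin.Properties as Fin
open import Data.List using (List; []; _∷_; length; filter; map; allFin; reverse)
open import Data.List.Properties using (filter-notAll; length-map; length-tabulate)
open import Data.List.Membership.Propositional using (_∈_; _∉_; find)
open import Data.List.Membership.Propositional.Properties using (∈-filter⁺; ∈-allFin; ∈-map⁺)
import Data.List.Membership.DecPropositional as DecMembership
open import Data.List.Relation.Binary.Subset.Propositional using (_⊆_)
open import Data.List.Relation.Unary.Any as Any using (Any; here; there; any?)
open import Data.List.Relation.Unary.All as All using (All; []; _∷_; all?)
open import Data.List.Relation.Unary.All.Properties using (all-filter)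
open import Data.List.Relation.Unary.AllPairs using (AllPairs; []; _∷_)
import Data.List.Relation.Unary.AllPairs.Properties as AllPairs
open import Data.List.Relation.Unary.Unique.Propositional using (Unique)
import Data.List.Relation.Unary.Unique.Propositional.Properties as Unique
open import Data.Vec using (lookup) renaming ([] to []ᵥ; _∷_ to _∷ᵥ_)
open import Data.Vec.Functional using (updateAt)
open import Data.Vec.Functional.Properties using (updateAt-updates; updateAt-minimal)
open import Data.Product using (Σ; ∃; _×_; _,_; proj₁; proj₂)
open import Data.Product.Properties using (≡-dec)
open import Data.Sum using (_⊎_; inj₁; inj₂)
open import Data.Unit using (⊤; tt)
open import Function using (_∘_; const; id)
open import Relation.Binary.Definitions using (DecidableEquality)
open import Relation.Nullary using (¬_; Dec; yes; no; ¬?; contradiction)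
open import Relation.Nullary.Decidable using (_×-dec_; _⊎-dec_; _→-dec_; toWitness)
open import Relation.Binary.PropositionalEquality using (_≡_; _≢_; refl; sym; trans; subst; ≢-sym)
open Relation.Binary.PropositionalEquality.≡-Reasoning

module DuplicateFree {A : Set} (_≟_ : DecidableEquality A) where

  open DecMembership _≟_ using (_∈?_)

  -- A duplicate-free list contained in another list is no longer than it:
  -- removing the head x from the larger list strictly shortens it and
  -- still contains the (x-free) tail.
  unique-⊆-length : {xs ys : List A} → Unique xs → xs ⊆ ys → length xs ≤ length ys
  unique-⊆-length {[]}     []            _   = z≤n
  unique-⊆-length {x ∷ xs} {ys} (x∉xs ∷ u) sub =
    ≤-<-trans (unique-⊆-length u tail⊆ys-x) (filter-notAll ≢x? ys x∈ys)
    where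
    ≢x? : ∀ y → Dec (y ≢ x)
    ≢x? y = ¬? (y ≟ x)
    tail⊆ys-x : xs ⊆ filter ≢x? ys
    tail⊆ys-x y∈xs = ∈-filter⁺ ≢x? (sub (there y∈xs)) (≢-sym (All.lookup x∉xs y∈xs))
    x∈ys : Any (λ y → ¬ ¬ (y ≡ x)) ys
    x∈ys = Any.map (λ { refl y≢x → y≢x refl }) (sub (here refl))

  -- The greedy step: a duplicate-free list longer than a forbidden list F
  -- contains an element outside F (otherwise it would fit inside F).
  free-element : {xs : List A} (F : List A) → Unique xs → length F < length xs →
                 ∃ λ c → c ∈ xs × c ∉ F
  free-element {xs} F u short with any? (λ c → ¬? (c ∈? F)) xs
  ... | yes someFree = find someFree
  ... | no  noneFree = contradiction (≤-<-trans (unique-⊆-length u xs⊆F) short) (<-irrefl refl)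
    where
    xs⊆F : xs ⊆ F
    xs⊆F {c} c∈xs with c ∈? F
    ... | yes c∈F = c∈F
    ... | no  c∉F = contradiction (Any.map (λ { refl → c∉F }) c∈xs) noneFree

unique-Fin-length : {m : ℕ} {zs : List (Fin m)} → Unique zs → length zs ≤ m
unique-Fin-length {m} u =
  ≤-trans (unique-⊆-length u (λ {z} _ → ∈-allFin z)) (≤-reflexive (length-tabulate id))
  where open DuplicateFree Fin._≟_

Separated : {n : ℕ} → (Fin n → List (Fin n)) → Fin n → Fin n → Set
Separated back x y = x ∈ back y ⊎ y ∈ back x

separated? : {n : ℕ} (back : Fin n → List (Fin n)) → ∀ x y → Dec (Separated back x y)
separated? back x y = (x ∈? back y) ⊎-dec (y ∈? back x)
  where open DecMembership Fin._≟_ using (_∈?_)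

module Greedy {n : ℕ} (k : ℕ) (back : Fin n → List (Fin n)) where

  -- A schedule lists vertices latest first.  Each vertex occurs once, its
  -- back-constraints are strictly earlier vertices, and there are fewer
  -- than k of them.
  Schedule : List (Fin n) → Set
  Schedule []       = ⊤
  Schedule (v ∷ vs) = (v ∉ vs × All (_∈ vs) (back v) × length (back v) < k) × Schedule vs

  schedule? : ∀ vs → Dec (Schedule vs)
  schedule? []       = yes tt
  schedule? (v ∷ vs) =
    (¬? (v ∈? vs) ×-dec all? (_∈? vs) (back v) ×-dec (length (back v) <? k)) ×-dec schedule? vs
    where open DecMembership Fin._≟_ using (_∈?_)

  back-closed : ∀ {vs w u} → Schedule vs → w ∈ vs → u ∈ back w → u ∈ vs
  back-closed ((_ , earlier , _) , _) (here refl)  u∈ = there (All.lookup earlier u∈)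
  back-closed (_ , s)                 (there w∈vs) u∈ = there (back-closed s w∈vs u∈)

  module _ (L : Fin n → List ℕ) (isAssignment : IsAssignment k L) where

    Respects : (Fin n → ℕ) → List (Fin n) → Set
    Respects f vs = ∀ {v} → v ∈ vs → f v ∈ L v × (∀ {u} → u ∈ back v → f v ≢ f u)

    -- Every schedule can be coloured greedily: colour the earlier vertices,
    -- then give the latest vertex a colour of its list not used by any of
    -- its fewer than k back-constraints.
    greedy : ∀ vs → Schedule vs → Σ (Fin n → ℕ) λ f → Respects f vs
    greedy []       _ = const 0 , λ ()
    greedy (v ∷ vs) ((v∉vs , earlier , few) , s) = f′ , respects′
      where
      f : Fin n → ℕ
      f = proj₁ (greedy vs s)
      respects : Respects f vs
      respects = proj₂ (greedy vs s)
      forbidden : List ℕ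
      forbidden = map f (back v)
      fewForbidden : length forbidden < length (L v)
      fewForbidden rewrite length-map f (back v) | proj₁ (isAssignment v) = few
      free : ∃ λ c → c ∈ L v × c ∉ forbidden
      free = free-element forbidden (proj₂ (isAssignment v)) fewForbidden
        where open DuplicateFree Data.Nat._≟_
      c : ℕ
      c = proj₁ free
      f′ : Fin n → ℕ
      f′ = updateAt f v (const c)
      recoloured : f′ v ≡ c
      recoloured = updateAt-updates v f
      -- v is new, so the earlier vertices keep their colours.
      unchanged : ∀ {x} → x ∈ vs → f′ x ≡ f x
      unchanged x∈vs = updateAt-minimal _ v f λ { refl → v∉vs x∈vs }
      respects′ : Respects f′ (v ∷ vs)
      respects′ (here refl) = subst (_∈ L v) (sym recoloured) (proj₁ (proj₂ free)) , differs
        where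
        differs : ∀ {u} → u ∈ back v → f′ v ≢ f′ u
        differs {u} u∈back eq = proj₂ (proj₂ free) (subst (_∈ forbidden) (sym c≡fu) (∈-map⁺ f u∈back))
          where
          c≡fu : c ≡ f u
          c≡fu = begin
            c      ≡⟨ sym recoloured ⟩
            f′ v   ≡⟨ eq ⟩
            f′ u   ≡⟨ unchanged (All.lookup earlier u∈back) ⟩
            f u    ∎
      respects′ {x} (there x∈vs) = subst (_∈ L x) (sym (unchanged x∈vs)) (proj₁ (respects x∈vs)) , differs
        where
        differs : ∀ {u} → u ∈ back x → f′ x ≢ f′ u
        differs {u} u∈back eq = proj₂ (respects x∈vs) u∈back (begin
          f x    ≡⟨ sym (unchanged x∈vs) ⟩
          f′ x   ≡⟨ eq ⟩
          f′ u   ≡⟨ unchanged (back-closed s x∈vs u∈back) ⟩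
          f u    ∎)

    separated-distinct : ∀ {vs f} → Respects f vs → (∀ v → v ∈ vs) →
                         ∀ {x y} → Separated back x y → f x ≢ f y
    separated-distinct respects scheduled (inj₁ x∈) = ≢-sym (proj₂ (respects (scheduled _)) x∈)
    separated-distinct respects scheduled (inj₂ y∈) = proj₂ (respects (scheduled _)) y∈

-- Equitability from classes: if the vertices are split into m classes and
-- f is injective on each class, then every colour is used at most m times,
-- since the vertices of one colour lie in pairwise different classes.
colourCount-≤ : {n m : ℕ} (f : Fin n → ℕ) (cls : Fin n → Fin m) →
                (∀ x y → x ≢ y → cls x ≡ cls y → f x ≢ f y) →
                ∀ c → colourCount f c ≤ m
colourCount-≤ {n} f cls injective c =
  subst (_≤ _) (length-map cls colourClass)
    (unique-Fin-length (AllPairs.map⁺ {f = cls}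
      (differentClasses (Unique.filter⁺ hasColour? (Unique.allFin⁺ n))
                        (all-filter hasColour? (allFin n)))))
  where
  hasColour? : ∀ v → Dec (f v ≡ c)
  hasColour? v = f v Data.Nat.≟ c
  colourClass : List (Fin n)
  colourClass = filter hasColour? (allFin n)
  differentClasses : ∀ {xs} → Unique xs → All (λ v → f v ≡ c) xs →
                     AllPairs (λ x y → cls x ≢ cls y) xs
  differentClasses []           []           = []
  differentClasses (x≢xs ∷ uxs) (fx≡c ∷ fxs) =
    All.zipWith (λ { (x≢y , fy≡c) sameClass → injective _ _ x≢y sameClass (trans fx≡c (sym fy≡c)) })
                (x≢xs , fxs)
    ∷ differentClasses uxs fxs

-- Decidability of the graphs involved, so that finite conditions about
-- them can be checked by evaluation.

fromEdges? : ∀ n E (x y : Fin n) → Dec (fromEdges n E x y)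
fromEdges? n E x y = ((toℕ x , toℕ y) ∈? E) ⊎-dec ((toℕ y , toℕ x) ∈? E)
  where open DecMembership (≡-dec Data.Nat._≟_ Data.Nat._≟_) using (_∈?_)

square? : {n : ℕ} {H : Graph n} → (∀ x y → Dec (H x y)) → ∀ x y → Dec (square H x y)
square? H? x y = ¬? (x Fin.≟ y) ×-dec (H? x y ⊎-dec Fin.any? (λ z → H? x z ×-dec H? z y))

G : Graph 9
G = square (Θ (2 ∷ 4 ∷ 4 ∷ []))

G? : ∀ x y → Dec (G x y)
G? = square? (fromEdges? 9 (thetaEdgesFrom (2 ∷ 4 ∷ 4 ∷ []) 2))

order : List (Fin 9)
order = reverse (# 0 ∷ # 1 ∷ # 2 ∷ # 3 ∷ # 4 ∷ # 5 ∷ # 8 ∷ # 6 ∷ # 7 ∷ [])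

-- Back-constraints: the earlier G-neighbours of each vertex, completed so
-- that {1,…,5} and {0,6,7,8} are pairwise separated.
back : Fin 9 → List (Fin 9)
back = lookup
  ( []
  ∷ᵥ (# 0 ∷ [])
  ∷ᵥ (# 0 ∷ # 1 ∷ [])
  ∷ᵥ (# 0 ∷ # 1 ∷ # 2 ∷ [])
  ∷ᵥ (# 0 ∷ # 1 ∷ # 2 ∷ # 3 ∷ [])
  ∷ᵥ (# 1 ∷ # 2 ∷ # 3 ∷ # 4 ∷ [])
  ∷ᵥ (# 0 ∷ # 2 ∷ # 3 ∷ # 8 ∷ [])
  ∷ᵥ (# 0 ∷ # 1 ∷ # 6 ∷ # 8 ∷ [])
  ∷ᵥ (# 0 ∷ # 1 ∷ # 2 ∷ # 5 ∷ [])
  ∷ᵥ []ᵥ)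

cls : Fin 9 → Fin 2
cls = lookup (# 0 ∷ᵥ # 1 ∷ᵥ # 1 ∷ᵥ # 1 ∷ᵥ # 1 ∷ᵥ # 1 ∷ᵥ # 0 ∷ᵥ # 0 ∷ᵥ # 0 ∷ᵥ []ᵥ)

open Greedy 5 back

scheduled : Schedule order
scheduled = toWitness {a? = schedule? order} tt

allScheduled : ∀ v → v ∈ order
allScheduled = toWitness {a? = Fin.all? (λ v → v ∈? order)} tt
  where open DecMembership Fin._≟_ using (_∈?_)

edgesSeparated : ∀ x y → G x y → Separated back x y
edgesSeparated = toWitness {a? = Fin.all? λ x → Fin.all? λ y → G? x y →-dec separated? back x y} tt

classesSeparated : ∀ x y → x ≢ y → cls x ≡ cls y → Separated back x y
classesSeparated = toWitness {a? = Fin.all? λ x → Fin.all? λ y →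
  ¬? (x Fin.≟ y) →-dec (cls x Fin.≟ cls y) →-dec separated? back x y} tt

lemma3p5 : EquitablyChoosable (square (Θ (2 ∷ 4 ∷ 4 ∷ []))) 5
lemma3p5 L isAssignment = f , proper , fromLists , equitable
  where
  colouring : Σ (Fin 9 → ℕ) λ f → Respects L isAssignment f order
  colouring = greedy L isAssignment order scheduled
  f : Fin 9 → ℕ
  f = proj₁ colouring
  distinct : ∀ {x y} → Separated back x y → f x ≢ f y
  distinct = separated-distinct L isAssignment (proj₂ colouring) allScheduled
  proper : Proper G f
  proper x y = distinct ∘ edgesSeparated x y
  fromLists : ∀ v → f v ∈ L v
  fromLists v = proj₁ (proj₂ colouring (allScheduled v))
  -- ⌈9/5⌉ = 2 colour classes suffice.
  equitable : ∀ c → colourCount f c ≤ 2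
  equitable = colourCount-≤ f cls λ x y x≢y sameClass → distinct (classesSeparated x y x≢y sameClass)
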